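{- Let $n\geq 1$. Let $c_1(n)$ be the number of partitions of $n$ in which one part occurs exactly three times and all other parts occur exactly once. Let $b_1(n)$ be the total number of parts in all partitions of $n$ into distinct parts minus the total number of different parts in all partitions of $n$ into odd parts, where in each partition into odd parts every distinct part value is counted once, regardless of its multiplicity. Then $c_1(n)=b_1(n)$.
   Context: A partition of $n$ is a non-increasing sequence of positive integers (its parts) summing to $n$. -}

module Defs where

open import Data.Nat using (ℕ; zero; suc; _∸_; _≤?_; _≟_; _%_)
open import Data.Nat.Base using (_⊓_)
open import Data.List using (List; []; _∷_; [_]; map; concatMap; filter; length; upTo; deduplicate)
open import Data.Bool using (Bool; true; false; _∧_)
open import Data.Bool.ListAction using (all)
open import Data.Nat.ListAction using (sum)
open import Data.Integer using (ℤ; +_; _-_)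
open import Relation.Nullary.Decidable using (⌊_⌋)

-- Non-increasing lists of positive integers, all parts ≤ m, summing to n.
-- 'fuel' only guarantees termination; fuel ≥ n suffices (each step removes a part ≥ 1).
boundedPartitions : (fuel n m : ℕ) → List (List ℕ)
boundedPartitions _        zero    _ = [ [] ]
boundedPartitions zero     (suc n) _ = []
boundedPartitions (suc f)  (suc n) m =
  concatMap (λ k → map (k ∷_) (boundedPartitions f (suc n ∸ k) k))
            (map suc (upTo (m ⊓ suc n)))

partitions : ℕ → List (List ℕ)
partitions n = boundedPartitions n n n

mult : ℕ → List ℕ → ℕ
mult x p = length (filter (λ y → x ≟ y) p)

distinctParts : List ℕ → List ℕ
distinctParts p = deduplicate _≟_ p

isDistinct : List ℕ → Bool
isDistinct p = all (λ x → ⌊ mult x p ≟ 1 ⌋) p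

isOdd : List ℕ → Bool
isOdd p = all (λ x → ⌊ x % 2 ≟ 1 ⌋) p

isC1 : List ℕ → Bool
isC1 p = ⌊ length (filter (λ x → mult x p ≟ 3) (distinctParts p)) ≟ 1 ⌋
       ∧ all (λ x → ⌊ mult x p ≟ 1 ⌋ Data.Bool.∨ ⌊ mult x p ≟ 3 ⌋) (distinctParts p)

count : (List ℕ → Bool) → List (List ℕ) → ℕ
count P ps = length (Data.List.filter (λ p → Data.Bool._≟_ (P p) true) ps)

c₁ : ℕ → ℕ
c₁ n = count isC1 (partitions n)

totalPartsDistinct : ℕ → ℕ
totalPartsDistinct n = sum (map length (filter (λ p → Data.Bool._≟_ (isDistinct p) true) (partitions n)))

totalDifferentPartsOdd : ℕ → ℕ
totalDifferentPartsOdd n =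
  sum (map (λ p → length (distinctParts p)) (filter (λ p → Data.Bool._≟_ (isOdd p) true) (partitions n)))

b₁ : ℕ → ℤ
b₁ n = + totalPartsDistinct n - + totalDifferentPartsOdd n

module Submission where

open import Defs
open import Data.Nat using (ℕ; _≤_)
open import Data.Integer using (+_)
open import Relation.Binary.PropositionalEquality using (_≡_)

-- Work with generating functions truncated to partitions whose parts are at most m: let D, L, C
-- count partitions into distinct parts, their parts, and the partitions counted by c₁, and let
-- O, T count partitions into odd parts and their different parts.  Splitting off the parts equal
-- to m + 1 gives recurrences in m, and induction on m yields
--   L = C + Σ_{k ≤ m} (q^k − q^{2k}) D   and   T = Σ_{k ≤ m, k odd} q^k O.
-- Modulo q^{m+1} the two sums agree, and O ≡ D (Euler): for m = 2r one proves
-- ∏_{j ≤ 2r} (1 − q^{2j}) O = ∏_{j ≤ r} (1 − q^{2j}) D (similarly for m = 2r + 1), where the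
-- factors with j > r are invisible modulo q^{2r+2} and multiplication by the rest is injective.
-- The coefficients of q^n for m = n then give L = C + T, that is c₁(n) = b₁(n).

module PowerSeries where

  open import Data.Nat as ℕ using (ℕ; zero; suc; s≤s; _<_; _≤_; _∸_)
  import Data.Nat.Properties as ℕ
  open import Data.Nat.DivMod using (_%_; [m+n]%n≡m%n)
  open import Data.Bool using (Bool; true; false; not; if_then_else_)
  open import Data.Integer using (ℤ; +_; _+_; _-_)
  import Data.Integer.Properties as ℤ
  open import Data.Integer.Tactic.RingSolver using (solve-∀)
  open import Data.Sum using (inj₁; inj₂)
  open import Function using (id; _∘_)
  open import Relation.Binary.PropositionalEquality
  import Relation.Binary.Reasoning.Setoid as SetoidReasoning
  open import Relation.Nullary.Decidable using (⌊_⌋)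

  Series : Set
  Series = ℕ → ℤ

  module ≗-Reasoning = SetoidReasoning (ℕ →-setoid ℤ)

  infix 4 _≈_mod-q^_
  _≈_mod-q^_ : Series → Series → ℕ → Set
  a ≈ b mod-q^ n = ∀ i → i < n → a i ≡ b i

  infixl 6 _⊕_ _⊖_
  _⊕_ _⊖_ : Series → Series → Series
  (a ⊕ b) n = a n + b n
  (a ⊖ b) n = a n - b n

  0ˢ : Series
  0ˢ _ = + 0

  infixr 7 q^_·_
  q^_·_ : ℕ → Series → Series
  (q^ zero  · a) n       = a n
  (q^ suc k · a) zero    = + 0
  (q^ suc k · a) (suc n) = (q^ k · a) n

  mod-weaken : ∀ {a b m n} → m ≤ n → a ≈ b mod-q^ n → a ≈ b mod-q^ m
  mod-weaken m≤n e i i<m = e i (ℕ.<-≤-trans i<m m≤n)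

  ≗⇒mod : ∀ {a b} → a ≗ b → ∀ n → a ≈ b mod-q^ n
  ≗⇒mod e n i _ = e i

  mod-extend : ∀ {a b n} → a ≈ b mod-q^ n → a n ≡ b n → a ≈ b mod-q^ suc n
  mod-extend a≈b aₙ≡bₙ i i<1+n with ℕ.m≤n⇒m<n∨m≡n (ℕ.≤-pred i<1+n)
  ... | inj₁ i<n  = a≈b i i<n
  ... | inj₂ refl = aₙ≡bₙ

  mod-induction : ∀ {a b} N → (∀ n → n < N → a ≈ b mod-q^ n → a n ≡ b n) → a ≈ b mod-q^ N
  mod-induction zero    step i ()
  mod-induction (suc N) step = mod-extend below (step N ℕ.≤-refl below)
    where below = mod-induction N (λ n n<N → step n (ℕ.m≤n⇒m≤1+n n<N))

  q^-coefficient : ∀ k a {n} → k ≤ n → (q^ k · a) n ≡ a (n ∸ k)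
  q^-coefficient zero    a _         = refl
  q^-coefficient (suc k) a (s≤s k≤n) = q^-coefficient k a k≤n

  q^-vanishes : ∀ k a {n} → n < k → (q^ k · a) n ≡ + 0
  q^-vanishes (suc k) a {zero}  _         = refl
  q^-vanishes (suc k) a {suc n} (s≤s n<k) = q^-vanishes k a n<k

  q^-+ : ∀ j k a → q^ j · q^ k · a ≗ q^ (j ℕ.+ k) · a
  q^-+ zero    k a n       = refl
  q^-+ (suc j) k a zero    = refl
  q^-+ (suc j) k a (suc n) = q^-+ j k a n

  q^-comm : ∀ j k a → q^ j · q^ k · a ≗ q^ k · q^ j · a
  q^-comm j k a n = begin
    (q^ j · q^ k · a) n    ≡⟨ q^-+ j k a n ⟩
    (q^ (j ℕ.+ k) · a) n   ≡⟨ cong (λ l → (q^ l · a) n) (ℕ.+-comm j k) ⟩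
    (q^ (k ℕ.+ j) · a) n   ≡⟨ q^-+ k j a n ⟨
    (q^ k · q^ j · a) n    ∎
    where open ≡-Reasoning

  q^-mod : ∀ k {a b n} → a ≈ b mod-q^ n → q^ k · a ≈ q^ k · b mod-q^ (k ℕ.+ n)
  q^-mod zero    e i       i<n       = e i i<n
  q^-mod (suc k) e zero    _         = refl
  q^-mod (suc k) e (suc i) (s≤s i<) = q^-mod k e i i<

  Op : Set
  Op = Series → Series

  0ᵒ : Op
  0ᵒ _ = 0ˢ

  infixl 6 _⊞_ _⊟_
  _⊞_ _⊟_ : Op → Op → Op
  (F ⊞ G) a = F a ⊕ G a
  (F ⊟ G) a = F a ⊖ G a

  record IsLinear (F : Op) : Set where
    field
      ⊕-hom   : ∀ a b → F (a ⊕ b) ≗ F a ⊕ F b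
      q^-hom  : ∀ k a → F (q^ k · a) ≗ q^ k · F a
      mod-hom : ∀ {a b} n → a ≈ b mod-q^ n → F a ≈ F b mod-q^ n

    ≗-hom : ∀ {a b} → a ≗ b → F a ≗ F b
    ≗-hom e n = mod-hom (suc n) (≗⇒mod e (suc n)) n ℕ.≤-refl

    ⊖-hom : ∀ a b → F (a ⊖ b) ≗ F a ⊖ F b
    ⊖-hom a b n = begin
      F (a ⊖ b) n                         ≡⟨ +-cancel (F (a ⊖ b) n) (F b n) ⟨
      F (a ⊖ b) n + F b n - F b n         ≡⟨ cong (_- F b n) (⊕-hom (a ⊖ b) b n) ⟨
      F (a ⊖ b ⊕ b) n - F b n             ≡⟨ cong (_- F b n) (≗-hom (λ i → −-cancel (a i) (b i)) n) ⟩
      F a n - F b n                       ∎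
      where
      open ≡-Reasoning
      +-cancel : ∀ x y → x + y - y ≡ x
      +-cancel = solve-∀
      −-cancel : ∀ x y → x - y + y ≡ x
      −-cancel = solve-∀

  open IsLinear public

  q^-isLinear : ∀ k → IsLinear (q^ k ·_)
  q^-isLinear zero = record
    { ⊕-hom = λ a b n → refl ; q^-hom = λ j a n → refl ; mod-hom = λ n e → e }
  q^-isLinear (suc k) = record
    { ⊕-hom   = ⊕-hom′
    ; q^-hom  = λ j a → q^-comm (suc k) j a
    ; mod-hom = λ n e → mod-weaken (ℕ.m≤n+m n (suc k)) (q^-mod (suc k) e)
    }
    where
    ⊕-hom′ : ∀ a b → q^ suc k · (a ⊕ b) ≗ q^ suc k · a ⊕ q^ suc k · b
    ⊕-hom′ a b zero    = refl
    ⊕-hom′ a b (suc n) = ⊕-hom (q^-isLinear k) a b n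

  q^-cong : ∀ k {a b} → a ≗ b → q^ k · a ≗ q^ k · b
  q^-cong k = ≗-hom (q^-isLinear k)

  ⊕-cong : ∀ {a a′ b b′} → a ≗ a′ → b ≗ b′ → a ⊕ b ≗ a′ ⊕ b′
  ⊕-cong e f n = cong₂ _+_ (e n) (f n)

  ⊕-congˡ : ∀ {a a′} b → a ≗ a′ → a ⊕ b ≗ a′ ⊕ b
  ⊕-congˡ b e n = cong (_+ b n) (e n)

  ⊕-congʳ : ∀ a {b b′} → b ≗ b′ → a ⊕ b ≗ a ⊕ b′
  ⊕-congʳ a e n = cong (_+_ (a n)) (e n)

  ⊕-assoc : ∀ a b c → (a ⊕ b) ⊕ c ≗ a ⊕ (b ⊕ c)
  ⊕-assoc a b c n = ℤ.+-assoc (a n) (b n) (c n)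

  ⊕-interchange : ∀ a b c d → (a ⊕ b) ⊕ (c ⊕ d) ≗ (a ⊕ c) ⊕ (b ⊕ d)
  ⊕-interchange a b c d n = interchange (a n) (b n) (c n) (d n)
    where
    interchange : ∀ x y u v → (x + y) + (u + v) ≡ (x + u) + (y + v)
    interchange = solve-∀

  ⊕-identityʳ : ∀ a → a ⊕ 0ˢ ≗ a
  ⊕-identityʳ a n = ℤ.+-identityʳ (a n)

  ⊕-identityˡ : ∀ a → 0ˢ ⊕ a ≗ a
  ⊕-identityˡ a n = ℤ.+-identityˡ (a n)

  q^-0ˢ : ∀ k → q^ k · 0ˢ ≗ 0ˢ
  q^-0ˢ zero    n       = refl
  q^-0ˢ (suc k) zero    = refl
  q^-0ˢ (suc k) (suc n) = q^-0ˢ k n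

  0ᵒ-isLinear : IsLinear 0ᵒ
  0ᵒ-isLinear = record
    { ⊕-hom   = λ a b n → refl
    ; q^-hom  = λ k a n → sym (q^-0ˢ k n)
    ; mod-hom = λ n e i i<n → refl
    }

  id-isLinear : IsLinear id
  id-isLinear = q^-isLinear 0

  ∘-isLinear : ∀ {F G} → IsLinear F → IsLinear G → IsLinear (F ∘ G)
  ∘-isLinear {F} {G} isF isG = record
    { ⊕-hom   = λ a b n → trans (≗-hom isF (⊕-hom isG a b) n) (⊕-hom isF (G a) (G b) n)
    ; q^-hom  = λ k a n → trans (≗-hom isF (q^-hom isG k a) n) (q^-hom isF k (G a) n)
    ; mod-hom = λ n e → mod-hom isF n (mod-hom isG n e)
    }

  ⊞-isLinear : ∀ {F G} → IsLinear F → IsLinear G → IsLinear (F ⊞ G)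
  ⊞-isLinear {F} {G} isF isG = record
    { ⊕-hom   = λ a b n → trans (⊕-cong (⊕-hom isF a b) (⊕-hom isG a b) n)
                                (⊕-interchange (F a) (F b) (G a) (G b) n)
    ; q^-hom  = λ k a n → trans (⊕-cong (q^-hom isF k a) (q^-hom isG k a) n)
                                (sym (⊕-hom (q^-isLinear k) (F a) (G a) n))
    ; mod-hom = λ n e i i<n → cong₂ _+_ (mod-hom isF n e i i<n) (mod-hom isG n e i i<n)
    }

  ⊟-isLinear : ∀ {F G} → IsLinear F → IsLinear G → IsLinear (F ⊟ G)
  ⊟-isLinear {F} {G} isF isG = record
    { ⊕-hom   = λ a b n → trans (cong₂ _-_ (⊕-hom isF a b n) (⊕-hom isG a b n))
                                (interchange (F a n) (F b n) (G a n) (G b n))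
    ; q^-hom  = λ k a n → trans (cong₂ _-_ (q^-hom isF k a n) (q^-hom isG k a n))
                                (sym (⊖-hom (q^-isLinear k) (F a) (G a) n))
    ; mod-hom = λ n e i i<n → cong₂ _-_ (mod-hom isF n e i i<n) (mod-hom isG n e i i<n)
    }
    where
    interchange : ∀ x y u v → (x + y) - (u + v) ≡ (x - u) + (y - v)
    interchange = solve-∀

  if-isLinear : ∀ b {F G} → IsLinear F → IsLinear G → IsLinear (if b then F else G)
  if-isLinear true  isF isG = isF
  if-isLinear false isF isG = isG

  1−q^_ : ℕ → Op
  1−q^ j = id ⊟ q^ j ·_

  1−q^-isLinear : ∀ j → IsLinear (1−q^ j)
  1−q^-isLinear j = ⊟-isLinear id-isLinear (q^-isLinear j)

  1−q^-below : ∀ j a {n} → n < j → (1−q^ j) a n ≡ a n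
  1−q^-below j a {n} n<j = trans (cong (a n -_) (q^-vanishes j a n<j)) (ℤ.+-identityʳ (a n))

  1−q^suc-injective : ∀ k {a b} N → (1−q^ suc k) a ≈ (1−q^ suc k) b mod-q^ N → a ≈ b mod-q^ N
  1−q^suc-injective k {a} {b} N e = mod-induction N step
    where
    step : ∀ n → n < N → a ≈ b mod-q^ n → a n ≡ b n
    step n n<N a≈b = begin
      a n                                         ≡⟨ −-cancel (a n) ((q^ suc k · a) n) ⟨
      (1−q^ suc k) a n + (q^ suc k · a) n         ≡⟨ cong₂ _+_ (e n n<N) (q^-mod (suc k) a≈b n (s≤s (ℕ.m≤n+m n k))) ⟩
      (1−q^ suc k) b n + (q^ suc k · b) n         ≡⟨ −-cancel (b n) ((q^ suc k · b) n) ⟩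
      b n                                         ∎
      where
      open ≡-Reasoning
      −-cancel : ∀ x y → x - y + y ≡ x
      −-cancel = solve-∀

  fixedPoint-unique : ∀ k a {b b′} → b ≗ a ⊕ q^ suc k · b → b′ ≗ a ⊕ q^ suc k · b′ → b ≗ b′
  fixedPoint-unique k a {b} {b′} eb eb′ n = mod-induction (suc n) step n ℕ.≤-refl
    where
    step : ∀ i → i < suc n → b ≈ b′ mod-q^ i → b i ≡ b′ i
    step i _ b≈b′ = begin
      b i                         ≡⟨ eb i ⟩
      a i + (q^ suc k · b) i      ≡⟨ cong (λ x → a i + x) (q^-mod (suc k) b≈b′ i (s≤s (ℕ.m≤n+m i k))) ⟩
      a i + (q^ suc k · b′) i     ≡⟨ eb′ i ⟨
      b′ i                        ∎
      where open ≡-Reasoning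

  q²-Pochhammer : ℕ → Op
  q²-Pochhammer zero    = id
  q²-Pochhammer (suc r) = 1−q^ (suc r ℕ.+ suc r) ∘ q²-Pochhammer r

  q²-Pochhammer-isLinear : ∀ r → IsLinear (q²-Pochhammer r)
  q²-Pochhammer-isLinear zero    = id-isLinear
  q²-Pochhammer-isLinear (suc r) =
    ∘-isLinear (1−q^-isLinear (suc r ℕ.+ suc r)) (q²-Pochhammer-isLinear r)

  q²-Pochhammer-injective : ∀ r {a b} N →
    q²-Pochhammer r a ≈ q²-Pochhammer r b mod-q^ N → a ≈ b mod-q^ N
  q²-Pochhammer-injective zero    N e = e
  q²-Pochhammer-injective (suc r) N e =
    q²-Pochhammer-injective r N (1−q^suc-injective (r ℕ.+ suc r) N e)

  q²-Pochhammer-stable : ∀ s r a →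
    q²-Pochhammer (s ℕ.+ r) a ≈ q²-Pochhammer r a mod-q^ (suc r ℕ.+ suc r)
  q²-Pochhammer-stable zero    r a i _   = refl
  q²-Pochhammer-stable (suc s) r a i i<2r+2 = begin
    (1−q^ K) (q²-Pochhammer (s ℕ.+ r) a) i   ≡⟨ 1−q^-below K (q²-Pochhammer (s ℕ.+ r) a) (ℕ.<-≤-trans i<2r+2 (ℕ.+-mono-≤ r+1≤ r+1≤)) ⟩
    q²-Pochhammer (s ℕ.+ r) a i              ≡⟨ q²-Pochhammer-stable s r a i i<2r+2 ⟩
    q²-Pochhammer r a i                      ∎
    where
    open ≡-Reasoning
    K = suc (s ℕ.+ r) ℕ.+ suc (s ℕ.+ r)
    r+1≤ : suc r ≤ suc (s ℕ.+ r)
    r+1≤ = s≤s (ℕ.m≤n+m r s)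

  q^Sum : (ℕ → Bool) → (ℕ → ℕ) → ℕ → Op
  q^Sum P f zero    = 0ᵒ
  q^Sum P f (suc m) = q^Sum P f m ⊞ (if P (suc m) then q^ f (suc m) ·_ else 0ᵒ)

  q^Sum-isLinear : ∀ P f m → IsLinear (q^Sum P f m)
  q^Sum-isLinear P f zero    = 0ᵒ-isLinear
  q^Sum-isLinear P f (suc m) =
    ⊞-isLinear (q^Sum-isLinear P f m) (if-isLinear (P (suc m)) (q^-isLinear (f (suc m))) 0ᵒ-isLinear)

  q^Sum-suc : ∀ P f m a → P (suc m) ≡ true → q^Sum P f (suc m) a ≗ q^Sum P f m a ⊕ q^ f (suc m) · a
  q^Sum-suc P f m a P[1+m] n rewrite P[1+m] = refl

  q^Sum-suc-skip : ∀ P f m a → P (suc m) ≡ false → q^Sum P f (suc m) a ≗ q^Sum P f m a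
  q^Sum-suc-skip P f m a ¬P[1+m] n rewrite ¬P[1+m] = ⊕-identityʳ (q^Sum P f m a) n

  q^Sum-split : ∀ P f m a → q^Sum (λ _ → true) f m a ≗ q^Sum P f m a ⊕ q^Sum (not ∘ P) f m a
  q^Sum-split P f zero    a n = refl
  q^Sum-split P f (suc m) a n with P (suc m)
  ... | true  = trans (cong (_+ (q^ f (suc m) · a) n) (q^Sum-split P f m a n))
                      (regroup (q^Sum P f m a n) _ _)
    where
    regroup : ∀ x y z → (x + y) + z ≡ (x + z) + (y + + 0)
    regroup = solve-∀
  ... | false = trans (cong (_+ (q^ f (suc m) · a) n) (q^Sum-split P f m a n))
                      (regroup (q^Sum P f m a n) _ _)
    where
    regroup : ∀ x y z → (x + y) + z ≡ (x + + 0) + (y + z)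
    regroup = solve-∀

  q^Sum-truncate : ∀ P t m a → q^Sum P id (t ℕ.+ m) a ≈ q^Sum P id m a mod-q^ suc m
  q^Sum-truncate P zero    m a i _   = refl
  q^Sum-truncate P (suc t) m a i i≤m = begin
    q^Sum P id (t ℕ.+ m) a i + (if P K then q^ K ·_ else 0ᵒ) a i   ≡⟨ cong (λ x → q^Sum P id (t ℕ.+ m) a i + x) (newTerm (P K)) ⟩
    q^Sum P id (t ℕ.+ m) a i + + 0                                  ≡⟨ ℤ.+-identityʳ (q^Sum P id (t ℕ.+ m) a i) ⟩
    q^Sum P id (t ℕ.+ m) a i                                        ≡⟨ q^Sum-truncate P t m a i i≤m ⟩
    q^Sum P id m a i                                                ∎
    where
    open ≡-Reasoning
    K = suc (t ℕ.+ m)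
    newTerm : ∀ b → (if b then q^ K ·_ else 0ᵒ) a i ≡ + 0
    newTerm true  = q^-vanishes K a (ℕ.<-≤-trans i≤m (s≤s (ℕ.m≤n+m m t)))
    newTerm false = refl

  odd : ℕ → Bool
  odd k = ⌊ k % 2 ℕ.≟ 1 ⌋

  odd-+2 : ∀ k → odd (suc (suc k)) ≡ odd k
  odd-+2 k = cong (λ r → ⌊ r ℕ.≟ 1 ⌋) (trans (cong (_% 2) (ℕ.+-comm 2 k)) ([m+n]%n≡m%n k 2))

  odd-double : ∀ m → odd (m ℕ.+ m) ≡ false
  odd-double zero    = refl
  odd-double (suc m) rewrite ℕ.+-suc m m = trans (odd-+2 (m ℕ.+ m)) (odd-double m)

  odd-1+double : ∀ m → odd (suc (m ℕ.+ m)) ≡ true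
  odd-1+double zero    = refl
  odd-1+double (suc m) rewrite ℕ.+-suc m m = trans (odd-+2 (suc (m ℕ.+ m))) (odd-1+double m)

  q^Sum-double : ∀ m a →
    q^Sum (λ _ → true) (λ k → k ℕ.+ k) m a ≗ q^Sum (not ∘ odd) id (m ℕ.+ m) a
  q^Sum-double zero    a n = refl
  q^Sum-double (suc m) a n
    rewrite ℕ.+-suc m m | odd-1+double m | odd-+2 (m ℕ.+ m) | odd-double m =
    trans (cong (_+ (q^ suc (suc (m ℕ.+ m)) · a) n) (q^Sum-double m a n))
          (cong (_+ (q^ suc (suc (m ℕ.+ m)) · a) n) (sym (ℤ.+-identityʳ (q^Sum (not ∘ odd) id (m ℕ.+ m) a n))))

  Σodd : ℕ → Op
  Σodd = q^Sum odd id

  Σodd-isLinear : ∀ m → IsLinear (Σodd m)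
  Σodd-isLinear = q^Sum-isLinear odd id

  Δ : ℕ → Op
  Δ m = q^Sum (λ _ → true) id m ⊟ q^Sum (λ _ → true) (λ k → k ℕ.+ k) m

  Δ-isLinear : ∀ m → IsLinear (Δ m)
  Δ-isLinear m = ⊟-isLinear (q^Sum-isLinear _ id m) (q^Sum-isLinear _ (λ k → k ℕ.+ k) m)

  Δ-suc : ∀ m a → Δ (suc m) a ≗ Δ m a ⊕ q^ suc m · a ⊖ q^ suc m · q^ suc m · a
  Δ-suc m a n = begin
    (s₁ + (q^ K · a) n) - (s₂ + (q^ (K ℕ.+ K) · a) n)   ≡⟨ cong (λ x → (s₁ + (q^ K · a) n) - (s₂ + x)) (q^-+ K K a n) ⟨
    (s₁ + (q^ K · a) n) - (s₂ + (q^ K · q^ K · a) n)     ≡⟨ regroup s₁ _ s₂ _ ⟩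
    (s₁ - s₂) + (q^ K · a) n - (q^ K · q^ K · a) n       ∎
    where
    open ≡-Reasoning
    K = suc m
    s₁ = q^Sum (λ _ → true) id m a n
    s₂ = q^Sum (λ _ → true) (λ k → k ℕ.+ k) m a n
    regroup : ∀ x y u v → (x + y) - (u + v) ≡ (x - u) + y - v
    regroup = solve-∀

  Δ≈Σodd : ∀ m a → Δ m a ≈ Σodd m a mod-q^ suc m
  Δ≈Σodd m a i i≤m = begin
    all i - doubled i                ≡⟨ cong₂ _-_ (q^Sum-split odd id m a i) (q^Sum-double m a i) ⟩
    oddPart i + evenPart i - q^Sum (not ∘ odd) id (m ℕ.+ m) a i
                                     ≡⟨ cong (λ x → oddPart i + evenPart i - x) (q^Sum-truncate (not ∘ odd) m m a i i≤m) ⟩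
    oddPart i + evenPart i - evenPart i
                                     ≡⟨ +-cancel (oddPart i) (evenPart i) ⟩
    oddPart i                        ∎
    where
    open ≡-Reasoning
    all = q^Sum (λ _ → true) id m a
    doubled = q^Sum (λ _ → true) (λ k → k ℕ.+ k) m a
    oddPart = q^Sum odd id m a
    evenPart = q^Sum (not ∘ odd) id m a
    +-cancel : ∀ x y → x + y - y ≡ x
    +-cancel = solve-∀

  1−q^2k-factor : ∀ k a → (1−q^ (k ℕ.+ k)) a ≗ (1−q^ k) (a ⊕ q^ k · a)
  1−q^2k-factor k a n = begin
    a n - (q^ (k ℕ.+ k) · a) n                                ≡⟨ cong (λ x → a n - x) (q^-+ k k a n) ⟨
    a n - (q^ k · q^ k · a) n                                 ≡⟨ telescope (a n) ((q^ k · a) n) ((q^ k · q^ k · a) n) ⟩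
    (a n + (q^ k · a) n) - ((q^ k · a) n + (q^ k · q^ k · a) n) ≡⟨ cong (λ x → a n + (q^ k · a) n - x) (⊕-hom (q^-isLinear k) a (q^ k · a) n) ⟨
    (1−q^ k) (a ⊕ q^ k · a) n                                 ∎
    where
    open ≡-Reasoning
    telescope : ∀ x y z → x - z ≡ (x + y) - (y + z)
    telescope = solve-∀

  1−q^2k-geometric : ∀ k {a b} → b ≗ a ⊕ q^ k · b → (1−q^ (k ℕ.+ k)) b ≗ a ⊕ q^ k · a
  1−q^2k-geometric k {a} {b} b≈ n = begin
    b n - (q^ (k ℕ.+ k) · b) n          ≡⟨ cong (λ x → b n - x) (q^-+ k k b n) ⟨
    b n - (q^ k · q^ k · b) n           ≡⟨ cancel {y = a n} {sy = (q^ k · a) n} (b≈ n) (trans (q^-cong k b≈ n) (⊕-hom (q^-isLinear k) a (q^ k · b) n)) ⟩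
    a n + (q^ k · a) n                  ∎
    where
    open ≡-Reasoning
    cancel : ∀ {x y sx sy ssx} → x ≡ y + sx → sx ≡ sy + ssx → x - ssx ≡ y + sy
    cancel {y = y} {sy = sy} {ssx} refl refl = simplify y sy ssx
      where
      simplify : ∀ y sy ssx → (y + (sy + ssx)) - ssx ≡ y + sy
      simplify = solve-∀

module Multiplicities where

  open import Data.Nat using (ℕ; zero; suc; _≟_; _+_)
  open import Data.Bool using (Bool; true; false; _∧_; _∨_)
  open import Data.Bool.ListAction using (and; all)
  open import Data.Bool.Properties using (∧-zeroʳ)
  open import Data.Empty using (⊥-elim)
  open import Data.List using (List; []; _∷_; _++_; filter; length; replicate)
  open import Data.List.Properties using (filter-accept; filter-reject; filter-none; filter-all; filter-idem; map-cong-local)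
  open import Data.List.Relation.Unary.All as All using (All; []; _∷_)
  open import Data.List.Relation.Unary.All.Properties using (filter⁺)
  open import Relation.Binary.PropositionalEquality
  open import Relation.Nullary using (yes; no; ¬?; contradiction)
  open import Relation.Nullary.Decidable using (⌊_⌋)

  Fresh : ℕ → List ℕ → Set
  Fresh K p = All (K ≢_) p

  mult-∷-≡ : ∀ x p → mult x (x ∷ p) ≡ suc (mult x p)
  mult-∷-≡ x p = cong length (filter-accept (x ≟_) {x} {p} refl)

  mult-replicate-++ : ∀ x j p → mult x (replicate j x ++ p) ≡ j + mult x p
  mult-replicate-++ x zero    p = refl
  mult-replicate-++ x (suc j) p = trans (mult-∷-≡ x (replicate j x ++ p)) (cong suc (mult-replicate-++ x j p))

  mult-replicate-++-≢ : ∀ {x y} j p → x ≢ y → mult x (replicate j y ++ p) ≡ mult x p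
  mult-replicate-++-≢     zero    p x≢y = refl
  mult-replicate-++-≢ {x} (suc j) p x≢y =
    trans (cong length (filter-reject (x ≟_) x≢y)) (mult-replicate-++-≢ j p x≢y)

  mult-fresh : ∀ {K p} → Fresh K p → mult K p ≡ 0
  mult-fresh fresh = cong length (filter-none (_ ≟_) fresh)

  mult-replicate-++-fresh : ∀ {K xs} j q → Fresh K xs → All (λ x → mult x (replicate j K ++ q) ≡ mult x q) xs
  mult-replicate-++-fresh j q = All.map (λ K≢x → mult-replicate-++-≢ j q (λ x≡K → K≢x (sym x≡K)))

  distinctParts-All : ∀ {P : ℕ → Set} {xs} → All P xs → All P (distinctParts xs)
  distinctParts-All []         = []
  distinctParts-All (px ∷ pxs) = px ∷ filter⁺ _ (distinctParts-All pxs)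

  distinctParts-fresh : ∀ {K p} → Fresh K p → distinctParts (K ∷ p) ≡ K ∷ distinctParts p
  distinctParts-fresh {K} fresh = cong (K ∷_) (filter-all (λ y → ¬? (K ≟ y)) (distinctParts-All fresh))

  distinctParts-repeat : ∀ K p → distinctParts (K ∷ K ∷ p) ≡ distinctParts (K ∷ p)
  distinctParts-repeat K p = cong (K ∷_) (trans (filter-reject (λ y → ¬? (K ≟ y)) {K} (λ K≢K → K≢K refl))
                                                (filter-idem (λ y → ¬? (K ≟ y)) (distinctParts p)))

  all-cong-local : ∀ {Q Q′ : ℕ → Bool} {xs} → All (λ x → Q x ≡ Q′ x) xs → all Q xs ≡ all Q′ xs
  all-cong-local = cong and ∘′ map-cong-local
    where open import Function using (_∘′_)

  all-distinctParts : ∀ Q xs → all Q (distinctParts xs) ≡ all Q xs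
  all-distinctParts Q []       = refl
  all-distinctParts Q (x ∷ xs) with Q x in Qx
  ... | false = refl
  ... | true  = trans (all-without Qx (distinctParts xs)) (all-distinctParts Q xs)
    where
    all-without : ∀ {x} → Q x ≡ true → ∀ ys → all Q (filter (λ y → ¬? (x ≟ y)) ys) ≡ all Q ys
    all-without Qx []       = refl
    all-without {x} Qx (y ∷ ys) with x ≟ y
    ... | yes refl = trans (cong (all Q) (filter-reject (λ y → ¬? (x ≟ y)) λ x≢x → x≢x refl))
                           (trans (all-without Qx ys) (cong (_∧ all Q ys) (sym Qx)))
    ... | no  x≢y  = trans (cong (all Q) (filter-accept (λ y → ¬? (x ≟ y)) x≢y))
                           (cong (Q y ∧_) (all-without Qx ys))

  isDistinct-fresh : ∀ {K p} → Fresh K p → isDistinct (K ∷ p) ≡ isDistinct p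
  isDistinct-fresh {K} {p} fresh = cong₂ _∧_
    (cong (λ n → ⌊ n ≟ 1 ⌋) (trans (mult-replicate-++ K 1 p) (cong suc (mult-fresh fresh))))
    (all-cong-local (All.map (cong (λ n → ⌊ n ≟ 1 ⌋)) (mult-replicate-++-fresh 1 p fresh)))

  isDistinct-repeat : ∀ K p → isDistinct (K ∷ K ∷ p) ≡ false
  isDistinct-repeat K p =
    cong (λ n → ⌊ n ≟ 1 ⌋ ∧ isDistinct′) (mult-replicate-++ K 2 p)
    where isDistinct′ = all (λ x → ⌊ mult x (K ∷ K ∷ p) ≟ 1 ⌋) (K ∷ p)

  c1Multiplicities : (ℕ → ℕ) → List ℕ → Bool
  c1Multiplicities μ ds =
    ⌊ length (filter (λ x → μ x ≟ 3) ds) ≟ 1 ⌋ ∧ all (λ x → ⌊ μ x ≟ 1 ⌋ ∨ ⌊ μ x ≟ 3 ⌋) ds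

  filter-≟-cong-local : ∀ {μ μ′ : ℕ → ℕ} c {xs} → All (λ x → μ x ≡ μ′ x) xs →
    filter (λ x → μ x ≟ c) xs ≡ filter (λ x → μ′ x ≟ c) xs
  filter-≟-cong-local c [] = refl
  filter-≟-cong-local {μ} {μ′} c {x ∷ xs} (e ∷ es) with μ x ≟ c
  ... | yes μx≡c = trans (filter-accept (λ x → μ x ≟ c) μx≡c)
                         (trans (cong (x ∷_) (filter-≟-cong-local c es))
                                (sym (filter-accept (λ x → μ′ x ≟ c) (trans (sym e) μx≡c))))
  ... | no  μx≢c = trans (filter-reject (λ x → μ x ≟ c) μx≢c)
                         (trans (filter-≟-cong-local c es)
                                (sym (filter-reject (λ x → μ′ x ≟ c) (λ μ′x≡c → μx≢c (trans e μ′x≡c)))))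

  c1Multiplicities-cong-local : ∀ {μ μ′} {ds} → All (λ x → μ x ≡ μ′ x) ds →
    c1Multiplicities μ ds ≡ c1Multiplicities μ′ ds
  c1Multiplicities-cong-local es = cong₂ (λ ts b → ⌊ length ts ≟ 1 ⌋ ∧ b)
    (filter-≟-cong-local 3 es) (all-cong-local (All.map (cong (λ n → ⌊ n ≟ 1 ⌋ ∨ ⌊ n ≟ 3 ⌋)) es))

  c1Multiplicities-∷-1 : ∀ μ K ds → μ K ≡ 1 → c1Multiplicities μ (K ∷ ds) ≡ c1Multiplicities μ ds
  c1Multiplicities-∷-1 μ K ds μK≡1
    rewrite filter-reject (λ x → μ x ≟ 3) {K} {ds} (λ μK≡3 → contradiction (trans (sym μK≡1) μK≡3) λ ())
          | μK≡1 = refl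

  c1Multiplicities-∷-other : ∀ μ K ds {k} → μ K ≡ k → k ≢ 1 → k ≢ 3 → c1Multiplicities μ (K ∷ ds) ≡ false
  c1Multiplicities-∷-other μ K ds refl k≢1 k≢3 with μ K ≟ 1 | μ K ≟ 3
  ... | yes μK≡1 | _         = ⊥-elim (k≢1 μK≡1)
  ... | no _     | yes μK≡3  = ⊥-elim (k≢3 μK≡3)
  ... | no _     | no _      = ∧-zeroʳ _

  c1Multiplicities-∷-3 : ∀ μ K ds → μ K ≡ 3 →
    c1Multiplicities μ (K ∷ ds) ≡ all (λ x → ⌊ μ x ≟ 1 ⌋) ds
  c1Multiplicities-∷-3 μ K ds μK≡3
    rewrite filter-accept (λ x → μ x ≟ 3) {K} {ds} μK≡3 | μK≡3 = noTriples ds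
    where
    noTriples : ∀ ds → ⌊ suc (length (filter (λ x → μ x ≟ 3) ds)) ≟ 1 ⌋ ∧ all (λ x → ⌊ μ x ≟ 1 ⌋ ∨ ⌊ μ x ≟ 3 ⌋) ds
                       ≡ all (λ x → ⌊ μ x ≟ 1 ⌋) ds
    noTriples []       = refl
    noTriples (x ∷ ds) with μ x ≟ 3
    ... | yes μx≡3 rewrite filter-accept (λ x → μ x ≟ 3) {x} {ds} μx≡3 | μx≡3 = refl
    ... | no  μx≢3 rewrite filter-reject (λ x → μ x ≟ 3) {x} {ds} μx≢3 with μ x ≟ 1
    ...   | yes _ = noTriples ds
    ...   | no  _ = ∧-zeroʳ _

  isC1-fresh : ∀ {K p} → Fresh K p → isC1 (K ∷ p) ≡ isC1 p
  isC1-fresh {K} {p} fresh = begin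
    c1Multiplicities μ (distinctParts (K ∷ p))   ≡⟨ cong (c1Multiplicities μ) (distinctParts-fresh fresh) ⟩
    c1Multiplicities μ (K ∷ distinctParts p)     ≡⟨ c1Multiplicities-∷-1 μ K _ μK≡1 ⟩
    c1Multiplicities μ (distinctParts p)         ≡⟨ c1Multiplicities-cong-local (distinctParts-All (mult-replicate-++-fresh 1 p fresh)) ⟩
    isC1 p                                       ∎
    where
    open ≡-Reasoning
    μ = λ x → mult x (K ∷ p)
    μK≡1 : μ K ≡ 1
    μK≡1 = trans (mult-replicate-++ K 1 p) (cong suc (mult-fresh fresh))

  isC1-double : ∀ {K p} → Fresh K p → isC1 (K ∷ K ∷ p) ≡ false
  isC1-double {K} {p} fresh = c1Multiplicities-∷-other (λ x → mult x (K ∷ K ∷ p)) K _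
    (trans (mult-replicate-++ K 2 p) (cong (_+_ 2) (mult-fresh fresh))) (λ ()) (λ ())

  isC1-triple : ∀ {K p} → Fresh K p → isC1 (K ∷ K ∷ K ∷ p) ≡ isDistinct p
  isC1-triple {K} {p} fresh = begin
    c1Multiplicities μ (distinctParts (K ∷ K ∷ K ∷ p))
      ≡⟨ cong (c1Multiplicities μ) (trans (distinctParts-repeat K (K ∷ p))
                                          (trans (distinctParts-repeat K p) (distinctParts-fresh fresh))) ⟩
    c1Multiplicities μ (K ∷ distinctParts p)
      ≡⟨ c1Multiplicities-∷-3 μ K _ μK≡3 ⟩
    all (λ x → ⌊ μ x ≟ 1 ⌋) (distinctParts p)
      ≡⟨ all-cong-local (All.map (cong (λ n → ⌊ n ≟ 1 ⌋)) (distinctParts-All μ≡mult)) ⟩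
    all (λ x → ⌊ mult x p ≟ 1 ⌋) (distinctParts p)
      ≡⟨ all-distinctParts (λ x → ⌊ mult x p ≟ 1 ⌋) p ⟩
    isDistinct p
      ∎
    where
    open ≡-Reasoning
    μ = λ x → mult x (K ∷ K ∷ K ∷ p)
    μK≡3 : μ K ≡ 3
    μK≡3 = trans (mult-replicate-++ K 3 p) (cong (_+_ 3) (mult-fresh fresh))
    μ≡mult : All (λ x → μ x ≡ mult x p) p
    μ≡mult = mult-replicate-++-fresh 3 p fresh

  isC1-quadruple : ∀ K p → isC1 (K ∷ K ∷ K ∷ K ∷ p) ≡ false
  isC1-quadruple K p =
    c1Multiplicities-∷-other (λ x → mult x (K ∷ K ∷ K ∷ K ∷ p)) K _ (mult-replicate-++ K 4 p) (λ ()) (λ ())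

module BoundedPartitions where

  open import Data.Nat using (ℕ; zero; suc; s≤s; _+_; _∸_; _⊓_; _≤_; _<_)
  open import Data.Nat.Properties
  open import Data.Nat.ListAction using (sum)
  open import Data.Nat.ListAction.Properties using (sum-++)
  open import Data.Nat.Tactic.RingSolver using (solve-∀)
  open import Data.Bool as Bool using (Bool; true; false; if_then_else_)
  open import Data.List using (List; []; _∷_; [_]; _++_; map; concatMap; upTo; _∷ʳ_; filter; length)
  open import Data.List.Properties using (map-++; concatMap-++; concatMap-map; concatMap-cong; upTo-∷ʳ; ++-identityʳ; map-∘; map-cong-local)
  open import Data.List.Relation.Unary.All as All using (All; []; _∷_)
  open import Data.List.Relation.Unary.All.Properties using (applyUpTo⁺₁; map⁺; concat⁺)
  open import Function using (_∘_)
  open import Relation.Binary.PropositionalEquality hiding ([_])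

  largestPartsUpTo : ℕ → ℕ → ℕ → List (List ℕ)
  largestPartsUpTo f n j = concatMap (λ k → map (suc k ∷_) (boundedPartitions f (n ∸ k) (suc k))) (upTo j)

  boundedPartitions-suc : ∀ f n m →
    boundedPartitions (suc f) (suc n) m ≡ largestPartsUpTo f n (m ⊓ suc n)
  boundedPartitions-suc f n m = concatMap-map _ suc (upTo (m ⊓ suc n))

  boundedPartitions-fuel : ∀ {f g n} m → n ≤ f → n ≤ g → boundedPartitions f n m ≡ boundedPartitions g n m
  boundedPartitions-fuel {n = zero}  m _ _ = refl
  boundedPartitions-fuel {suc f} {suc g} {suc n} m (s≤s n≤f) (s≤s n≤g) = begin
    boundedPartitions (suc f) (suc n) m   ≡⟨ boundedPartitions-suc f n m ⟩
    largestPartsUpTo f n (m ⊓ suc n)      ≡⟨ concatMap-cong fuel-irrelevant (upTo (m ⊓ suc n)) ⟩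
    largestPartsUpTo g n (m ⊓ suc n)      ≡⟨ boundedPartitions-suc g n m ⟨
    boundedPartitions (suc g) (suc n) m   ∎
    where
    open ≡-Reasoning
    fuel-irrelevant : ∀ k → map (suc k ∷_) (boundedPartitions f (n ∸ k) (suc k))
                          ≡ map (suc k ∷_) (boundedPartitions g (n ∸ k) (suc k))
    fuel-irrelevant k = cong (map (suc k ∷_))
      (boundedPartitions-fuel (suc k) (≤-trans (m∸n≤m n k) n≤f) (≤-trans (m∸n≤m n k) n≤g))

  boundedPartitions-suc-≥ : ∀ f {n m} → n ≤ m → boundedPartitions f n (suc m) ≡ boundedPartitions f n m
  boundedPartitions-suc-≥ f       {zero}  _ = refl
  boundedPartitions-suc-≥ zero    {suc n} _ = refl
  boundedPartitions-suc-≥ (suc f) {suc n} {m} n<m = begin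
    boundedPartitions (suc f) (suc n) (suc m)  ≡⟨ boundedPartitions-suc f n (suc m) ⟩
    largestPartsUpTo f n (suc (m ⊓ n))         ≡⟨ cong (λ j → largestPartsUpTo f n (suc j)) (m≥n⇒m⊓n≡n (≤-trans (n≤1+n n) n<m)) ⟩
    largestPartsUpTo f n (suc n)               ≡⟨ cong (largestPartsUpTo f n) (m≥n⇒m⊓n≡n n<m) ⟨
    largestPartsUpTo f n (m ⊓ suc n)           ≡⟨ boundedPartitions-suc f n m ⟨
    boundedPartitions (suc f) (suc n) m        ∎
    where open ≡-Reasoning

  boundedPartitions-suc-< : ∀ f {n m} → m ≤ n →
    boundedPartitions (suc f) (suc n) (suc m)
      ≡ boundedPartitions (suc f) (suc n) m ++ map (suc m ∷_) (boundedPartitions f (n ∸ m) (suc m))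
  boundedPartitions-suc-< f {n} {m} m≤n = begin
    boundedPartitions (suc f) (suc n) (suc m)  ≡⟨ boundedPartitions-suc f n (suc m) ⟩
    largestPartsUpTo f n (suc (m ⊓ n))         ≡⟨ cong (λ j → largestPartsUpTo f n (suc j)) (m≤n⇒m⊓n≡m m≤n) ⟩
    largestPartsUpTo f n (suc m)               ≡⟨ cong (concatMap F) (upTo-∷ʳ m) ⟨
    concatMap F (upTo m ∷ʳ m)                  ≡⟨ concatMap-++ F (upTo m) [ m ] ⟩
    largestPartsUpTo f n m ++ F m ++ []        ≡⟨ cong (largestPartsUpTo f n m ++_) (++-identityʳ (F m)) ⟩
    largestPartsUpTo f n m ++ F m              ≡⟨ cong (λ j → largestPartsUpTo f n j ++ F m) (m≤n⇒m⊓n≡m (m≤n⇒m≤1+n m≤n)) ⟨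
    largestPartsUpTo f n (m ⊓ suc n) ++ F m    ≡⟨ cong (_++ F m) (boundedPartitions-suc f n m) ⟨
    boundedPartitions (suc f) (suc n) m ++ F m ∎
    where
    open ≡-Reasoning
    F = λ k → map (suc k ∷_) (boundedPartitions f (n ∸ k) (suc k))

  boundedPartitions-bounded : ∀ f n m → All (All (_≤ m)) (boundedPartitions f n m)
  boundedPartitions-bounded f       zero    m = [] ∷ []
  boundedPartitions-bounded zero    (suc n) m = []
  boundedPartitions-bounded (suc f) (suc n) m
    rewrite boundedPartitions-suc f n m =
    concat⁺ (map⁺ (applyUpTo⁺₁ (λ i → i) (m ⊓ suc n) (λ k<j → bounded (≤-trans k<j (m⊓n≤m m (suc n))))))
    where
    bounded : ∀ {k} → suc k ≤ m → All (All (_≤ m)) (map (suc k ∷_) (boundedPartitions f (n ∸ k) (suc k)))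
    bounded {k} k<m = map⁺ (All.map (λ ps → k<m ∷ All.map (λ p≤k → ≤-trans p≤k k<m) ps)
                                (boundedPartitions-bounded f (n ∸ k) (suc k)))

  partitionSum : (List ℕ → ℕ) → ℕ → ℕ → ℕ
  partitionSum w m n = sum (map w (boundedPartitions n n m))

  partitionSum-suc-< : ∀ w {m n} → m < n →
    partitionSum w (suc m) n ≡ partitionSum w m n + partitionSum (w ∘ (suc m ∷_)) (suc m) (n ∸ suc m)
  partitionSum-suc-< w {m} {suc n} (s≤s m≤n) = begin
    sum (map w (boundedPartitions (suc n) (suc n) (suc m)))
      ≡⟨ cong (sum ∘ map w) (boundedPartitions-suc-< n m≤n) ⟩
    sum (map w (boundedPartitions (suc n) (suc n) m ++ map (suc m ∷_) smaller))
      ≡⟨ cong sum (map-++ w (boundedPartitions (suc n) (suc n) m) (map (suc m ∷_) smaller)) ⟩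
    sum (map w (boundedPartitions (suc n) (suc n) m) ++ map w (map (suc m ∷_) smaller))
      ≡⟨ sum-++ (map w (boundedPartitions (suc n) (suc n) m)) _ ⟩
    partitionSum w m (suc n) + sum (map w (map (suc m ∷_) smaller))
      ≡⟨ cong (λ ps → partitionSum w m (suc n) + sum ps) (map-∘ smaller) ⟨
    partitionSum w m (suc n) + sum (map (w ∘ (suc m ∷_)) smaller)
      ≡⟨ cong (λ ps → partitionSum w m (suc n) + sum (map (w ∘ (suc m ∷_)) ps))
              (boundedPartitions-fuel (suc m) (m∸n≤m n m) ≤-refl) ⟩
    partitionSum w m (suc n) + partitionSum (w ∘ (suc m ∷_)) (suc m) (n ∸ m)
      ∎
    where
    open ≡-Reasoning
    smaller = boundedPartitions n (n ∸ m) (suc m)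

  partitionSum-suc-≥ : ∀ w {m n} → n ≤ m → partitionSum w (suc m) n ≡ partitionSum w m n
  partitionSum-suc-≥ w {n = n} n≤m = cong (sum ∘ map w) (boundedPartitions-suc-≥ n n≤m)

  partitionSum-cong : ∀ {w w′} m n → (∀ p → All (_≤ m) p → w p ≡ w′ p) →
    partitionSum w m n ≡ partitionSum w′ m n
  partitionSum-cong m n w≡w′ =
    cong sum (map-cong-local (All.map (w≡w′ _) (boundedPartitions-bounded n n m)))

  partitionSum-+ : ∀ w w′ m n →
    partitionSum (λ p → w p + w′ p) m n ≡ partitionSum w m n + partitionSum w′ m n
  partitionSum-+ w w′ m n = sum-map-+ (boundedPartitions n n m)
    where
    interchange : ∀ a b c d → (a + b) + (c + d) ≡ (a + c) + (b + d)
    interchange = solve-∀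
    sum-map-+ : ∀ ps → sum (map (λ p → w p + w′ p) ps) ≡ sum (map w ps) + sum (map w′ ps)
    sum-map-+ []       = refl
    sum-map-+ (p ∷ ps) = trans (cong (_+_ (w p + w′ p)) (sum-map-+ ps)) (interchange (w p) (w′ p) _ _)

  partitionSum-0 : ∀ m n → partitionSum (λ _ → 0) m n ≡ 0
  partitionSum-0 m n = sum-zeros (boundedPartitions n n m)
    where
    sum-zeros : ∀ (ps : List (List ℕ)) → sum (map (λ _ → 0) ps) ≡ 0
    sum-zeros []       = refl
    sum-zeros (_ ∷ ps) = sum-zeros ps

  restrict : (List ℕ → Bool) → (List ℕ → ℕ) → List ℕ → ℕ
  restrict Q f p = if Q p then f p else 0

  sum-filter : ∀ (Q : List ℕ → Bool) f ps →
    sum (map f (filter (λ p → Q p Bool.≟ true) ps)) ≡ sum (map (restrict Q f) ps)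
  sum-filter Q f []       = refl
  sum-filter Q f (p ∷ ps) with Q p
  ... | true  = cong (_+_ (f p)) (sum-filter Q f ps)
  ... | false = sum-filter Q f ps

  count≡partitionSum : ∀ Q n → count Q (partitions n) ≡ partitionSum (restrict Q (λ _ → 1)) n n
  count≡partitionSum Q n =
    trans (length-as-sum (filter (λ p → Q p Bool.≟ true) (partitions n))) (sum-filter Q (λ _ → 1) (partitions n))
    where
    length-as-sum : ∀ (xs : List (List ℕ)) → length xs ≡ sum (map (λ _ → 1) xs)
    length-as-sum []       = refl
    length-as-sum (_ ∷ xs) = cong suc (length-as-sum xs)

module GeneratingFunctions where

  open PowerSeries
  open Multiplicities
  open BoundedPartitions
  open import Data.Nat as ℕ using (ℕ; zero; suc; _≤_)
  import Data.Nat.Properties as ℕ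
  open import Data.Integer using (+_; _+_)
  open import Data.Integer.Properties as ℤ using (pos-+)
  open import Data.List using (List; []; _∷_)
  open import Data.List.Relation.Unary.All as All using (All)
  open import Function using () renaming (_∘′_ to _∘_)
  open import Relation.Binary.PropositionalEquality
  open import Relation.Nullary using (yes; no)

  gf : (List ℕ → ℕ) → ℕ → Series
  gf w m n = + partitionSum w m n

  gf-suc : ∀ w m → gf w (suc m) ≗ gf w m ⊕ q^ suc m · gf (w ∘ (suc m ∷_)) (suc m)
  gf-suc w m n with suc m ℕ.≤? n
  ... | yes m<n = begin
    + partitionSum w (suc m) n                                        ≡⟨ cong +_ (partitionSum-suc-< w m<n) ⟩
    + (partitionSum w m n ℕ.+ partitionSum w′ (suc m) (n ℕ.∸ suc m))  ≡⟨ pos-+ (partitionSum w m n) _ ⟩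
    gf w m n + gf w′ (suc m) (n ℕ.∸ suc m)                            ≡⟨ cong (_+_ (gf w m n)) (q^-coefficient (suc m) (gf w′ (suc m)) m<n) ⟨
    gf w m n + (q^ suc m · gf w′ (suc m)) n                           ∎
    where
    open ≡-Reasoning
    w′ = w ∘ (suc m ∷_)
  ... | no  m≮n = begin
    + partitionSum w (suc m) n                              ≡⟨ cong +_ (partitionSum-suc-≥ w (ℕ.≤-pred (ℕ.≰⇒> m≮n))) ⟩
    gf w m n                                                ≡⟨ ℤ.+-identityʳ (gf w m n) ⟨
    gf w m n + + 0                                          ≡⟨ cong (_+_ (gf w m n)) (q^-vanishes (suc m) _ (ℕ.≰⇒> m≮n)) ⟨
    gf w m n + (q^ suc m · gf (w ∘ (suc m ∷_)) (suc m)) n   ∎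
    where
    open ≡-Reasoning

  gf-cong : ∀ {w w′} m → (∀ p → All (_≤ m) p → w p ≡ w′ p) → gf w m ≗ gf w′ m
  gf-cong m w≡w′ n = cong +_ (partitionSum-cong m n w≡w′)

  gf-+ : ∀ w w′ m → gf (λ p → w p ℕ.+ w′ p) m ≗ gf w m ⊕ gf w′ m
  gf-+ w w′ m n = trans (cong +_ (partitionSum-+ w w′ m n)) (pos-+ (partitionSum w m n) _)

  gf-vanishes : ∀ {w} m → (∀ p → All (_≤ m) p → w p ≡ 0) → gf w m ≗ 0ˢ
  gf-vanishes m w≡0 n = trans (gf-cong m w≡0 n) (cong +_ (partitionSum-0 m n))

  gf-base : ∀ {w w′} → w [] ≡ w′ [] → gf w 0 ≗ gf w′ 0
  gf-base e zero    = cong (λ x → + (x ℕ.+ 0)) e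
  gf-base e (suc n) = refl

  gf-empty : ∀ {w} → w [] ≡ 0 → gf w 0 ≗ 0ˢ
  gf-empty w[]≡0 n = trans (gf-base w[]≡0 n) (gf-vanishes 0 (λ _ _ → refl) n)

  bounded⇒fresh : ∀ {m p} → All (_≤ m) p → Fresh (suc m) p
  bounded⇒fresh = All.map (λ p≤m m+1≡p → ℕ.1+n≰n (subst (_≤ _) (sym m+1≡p) p≤m))

  gf-largest : ∀ w {w₁} m → (∀ p → Fresh (suc m) p → w (suc m ∷ p) ≡ w₁ p) →
    gf (w ∘ (suc m ∷_)) (suc m) ≗ gf w₁ m ⊕ q^ suc m · gf (w ∘ (suc m ∷_) ∘ (suc m ∷_)) (suc m)
  gf-largest w m w≡w₁ n = trans (gf-suc (w ∘ (suc m ∷_)) m n)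
    (⊕-congˡ (q^ suc m · gf (w ∘ (suc m ∷_) ∘ (suc m ∷_)) (suc m)) (gf-cong m (λ p → w≡w₁ p ∘ bounded⇒fresh)) n)

  gf-suc-absent : ∀ w m → (∀ p → w (suc m ∷ p) ≡ 0) → gf w (suc m) ≗ gf w m
  gf-suc-absent w m w≡0 = begin
    gf w (suc m)                                  ≈⟨ gf-suc w m ⟩
    gf w m ⊕ q^ suc m · gf (w ∘ (suc m ∷_)) (suc m) ≈⟨ ⊕-congʳ (gf w m) (q^-cong (suc m) (gf-vanishes (suc m) (λ p _ → w≡0 p))) ⟩
    gf w m ⊕ q^ suc m · 0ˢ                        ≈⟨ ⊕-congʳ (gf w m) (q^-0ˢ (suc m)) ⟩
    gf w m ⊕ 0ˢ                                   ≈⟨ ⊕-identityʳ (gf w m) ⟩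
    gf w m                                        ∎
    where open ≗-Reasoning

  gf-largest-last : ∀ w {w₁} m → (∀ p → Fresh (suc m) p → w (suc m ∷ p) ≡ w₁ p) →
    (∀ p → w (suc m ∷ suc m ∷ p) ≡ 0) → gf (w ∘ (suc m ∷_)) (suc m) ≗ gf w₁ m
  gf-largest-last w m w≡w₁ w≡0 n =
    trans (gf-suc-absent (w ∘ (suc m ∷_)) m w≡0 n) (gf-cong m (λ p → w≡w₁ p ∘ bounded⇒fresh) n)

module Recurrences where

  open PowerSeries
  open Multiplicities
  open BoundedPartitions
  open GeneratingFunctions
  open ≗-Reasoning
  open import Data.Nat as ℕ using (ℕ; suc)
  import Data.Nat.Properties as ℕ
  open import Data.Bool using (true; false; _∧_; if_then_else_)
  open import Data.List using (_∷_; length)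
  open import Function using () renaming (_∘′_ to _∘_)
  open import Relation.Binary.PropositionalEquality

  D L C O T : ℕ → Series
  D = gf (restrict isDistinct (λ _ → 1))
  L = gf (restrict isDistinct length)
  C = gf (restrict isC1 (λ _ → 1))
  O = gf (restrict isOdd (λ _ → 1))
  T = gf (restrict isOdd (length ∘ distinctParts))

  indicator-cong : ∀ {b b′} → b ≡ b′ → (if b then 1 else 0) ≡ (if b′ then 1 else 0)
  indicator-cong = cong (λ b → if b then 1 else 0)

  D-suc : ∀ m → D (suc m) ≗ D m ⊕ q^ suc m · D m
  D-suc m = begin
    D (suc m)                         ≈⟨ gf-suc w m ⟩
    D m ⊕ q^ K · gf (w ∘ (K ∷_)) K    ≈⟨ ⊕-congʳ (D m) (q^-cong K (gf-largest-last w m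
                                           (λ p fresh → indicator-cong (isDistinct-fresh fresh))
                                           (λ p → indicator-cong (isDistinct-repeat K p)))) ⟩
    D m ⊕ q^ K · D m                  ∎
    where
    K = suc m
    w = restrict isDistinct (λ _ → 1)

  L-suc : ∀ m → L (suc m) ≗ L m ⊕ q^ suc m · (L m ⊕ D m)
  L-suc m = begin
    L (suc m)                         ≈⟨ gf-suc w m ⟩
    L m ⊕ q^ K · gf (w ∘ (K ∷_)) K    ≈⟨ ⊕-congʳ (L m) (q^-cong K (gf-largest-last w m one-more-part
                                           (λ p → cong (λ b → if b then suc (suc (length p)) else 0) (isDistinct-repeat K p)))) ⟩
    L m ⊕ q^ K · gf (λ p → w p ℕ.+ restrict isDistinct (λ _ → 1) p) m
                                      ≈⟨ ⊕-congʳ (L m) (q^-cong K (gf-+ w _ m)) ⟩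
    L m ⊕ q^ K · (L m ⊕ D m)          ∎
    where
    K = suc m
    w = restrict isDistinct length
    one-more-part : ∀ p → Fresh K p → w (K ∷ p) ≡ w p ℕ.+ restrict isDistinct (λ _ → 1) p
    one-more-part p fresh rewrite isDistinct-fresh fresh with isDistinct p
    ... | true  = ℕ.+-comm 1 (length p)
    ... | false = refl

  C-suc : ∀ m → C (suc m) ≗ C m ⊕ q^ suc m · (C m ⊕ q^ suc m · q^ suc m · D m)
  C-suc m = begin
    C (suc m)                                 ≈⟨ gf-suc w m ⟩
    C m ⊕ q^ K · gf (w ∘ (K ∷_)) K            ≈⟨ ⊕-congʳ (C m) (q^-cong K (gf-largest w m (λ p fresh → indicator-cong (isC1-fresh fresh)))) ⟩
    C m ⊕ q^ K · (C m ⊕ q^ K · gf (w ∘ (K ∷_) ∘ (K ∷_)) K)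
                                              ≈⟨ ⊕-congʳ (C m) (q^-cong K (⊕-congʳ (C m) (q^-cong K twice))) ⟩
    C m ⊕ q^ K · (C m ⊕ q^ K · q^ K · D m)    ∎
    where
    K = suc m
    w = restrict isC1 (λ _ → 1)
    thrice : gf (w ∘ (K ∷_) ∘ (K ∷_) ∘ (K ∷_)) K ≗ D m
    thrice = gf-largest-last (w ∘ (K ∷_) ∘ (K ∷_)) m (λ p fresh → indicator-cong (isC1-triple fresh))
                                                     (λ p → indicator-cong (isC1-quadruple K p))
    twice : gf (w ∘ (K ∷_) ∘ (K ∷_)) K ≗ q^ K · D m
    twice = begin
      gf (w ∘ (K ∷_) ∘ (K ∷_)) K                                         ≈⟨ gf-largest (w ∘ (K ∷_)) m (λ p fresh → indicator-cong (isC1-double fresh)) ⟩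
      gf (λ _ → 0) m ⊕ q^ K · gf (w ∘ (K ∷_) ∘ (K ∷_) ∘ (K ∷_)) K       ≈⟨ ⊕-cong (gf-vanishes m (λ _ _ → refl)) (q^-cong K thrice) ⟩
      0ˢ ⊕ q^ K · D m                                                    ≈⟨ ⊕-identityˡ (q^ K · D m) ⟩
      q^ K · D m                                                         ∎

  O-suc-odd : ∀ m → odd (suc m) ≡ true → O (suc m) ≗ O m ⊕ q^ suc m · O (suc m)
  O-suc-odd m K-odd = begin
    O (suc m)                         ≈⟨ gf-suc w m ⟩
    O m ⊕ q^ K · gf (w ∘ (K ∷_)) K    ≈⟨ ⊕-congʳ (O m) (q^-cong K (gf-cong K (λ p _ → cong (λ b → if b ∧ isOdd p then 1 else 0) K-odd))) ⟩
    O m ⊕ q^ K · O K                  ∎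
    where
    K = suc m
    w = restrict isOdd (λ _ → 1)

  O-suc-even : ∀ m → odd (suc m) ≡ false → O (suc m) ≗ O m
  O-suc-even m K-even =
    gf-suc-absent (restrict isOdd (λ _ → 1)) m (λ p → cong (λ b → if b ∧ isOdd p then 1 else 0) K-even)

  T⁺ : ℕ → Series
  T⁺ m = gf (restrict isOdd (length ∘ distinctParts) ∘ (suc m ∷_)) (suc m)

  T-suc : ∀ m → T (suc m) ≗ T m ⊕ q^ suc m · T⁺ m
  T-suc m = gf-suc (restrict isOdd (length ∘ distinctParts)) m

  T⁺-odd : ∀ m → odd (suc m) ≡ true → T⁺ m ≗ (T m ⊕ O m) ⊕ q^ suc m · T⁺ m
  T⁺-odd m K-odd = begin
    T⁺ m                                                           ≈⟨ gf-largest w m new-part ⟩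
    gf (λ p → w p ℕ.+ restrict isOdd (λ _ → 1) p) m ⊕ q^ K · gf (w ∘ (K ∷_) ∘ (K ∷_)) K
                                                                   ≈⟨ ⊕-cong (gf-+ w _ m) (q^-cong K (gf-cong K (λ p _ → repeated-part p))) ⟩
    (T m ⊕ O m) ⊕ q^ K · T⁺ m                                      ∎
    where
    K = suc m
    w = restrict isOdd (length ∘ distinctParts)
    new-part : ∀ p → Fresh K p → w (K ∷ p) ≡ w p ℕ.+ restrict isOdd (λ _ → 1) p
    new-part p fresh =
      trans (cong₂ (λ b ds → if b ∧ isOdd p then length ds else 0) K-odd (distinctParts-fresh fresh))
            (one-more (isOdd p))
      where
      one-more : ∀ c → (if c then suc (length (distinctParts p)) else 0)
                     ≡ (if c then length (distinctParts p) else 0) ℕ.+ (if c then 1 else 0)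
      one-more true  = ℕ.+-comm 1 (length (distinctParts p))
      one-more false = refl
    repeated-part : ∀ p → w (K ∷ K ∷ p) ≡ w (K ∷ p)
    repeated-part p =
      trans (cong₂ (λ b ds → if b ∧ (b ∧ isOdd p) then length ds else 0) K-odd (distinctParts-repeat K p))
            (cong (λ b → if b ∧ isOdd p then length (distinctParts (K ∷ p)) else 0) (sym K-odd))

  T-suc-even : ∀ m → odd (suc m) ≡ false → T (suc m) ≗ T m
  T-suc-even m K-even = gf-suc-absent (restrict isOdd (length ∘ distinctParts)) m (λ p →
    cong (λ b → if b ∧ isOdd p then length (distinctParts (suc m ∷ p)) else 0) K-even)

module Identities where

  open PowerSeries
  open GeneratingFunctions
  open Recurrences
  open import Data.Nat as ℕ using (zero; suc; s≤s)
  import Data.Nat.Properties as ℕ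
  open import Data.Integer using (+_; _+_; _-_)
  open import Data.Integer.Tactic.RingSolver using (solve-∀)
  open import Data.Bool using (true; false)
  open import Data.Product using (∃-syntax; _,_)
  open import Data.Sum using (_⊎_; inj₁; inj₂)
  open import Function using (id; _∘_)
  open import Relation.Binary.PropositionalEquality

  parity-cases : ∀ {P : Set} k → (odd k ≡ true → P) → (odd k ≡ false → P) → P
  parity-cases k if-odd if-even with odd k
  ... | true  = if-odd refl
  ... | false = if-even refl

  odd-parts-step-odd : ∀ m → T m ≗ Σodd m (O m) → odd (suc m) ≡ true → T (suc m) ≗ Σodd (suc m) (O (suc m))
  odd-parts-step-odd m T≈ K-odd = begin
    T K                                         ≈⟨ T-suc m ⟩
    T m ⊕ q^ K · T⁺ m                           ≈⟨ ⊕-congʳ (T m) (q^-cong K T⁺≈) ⟩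
    T m ⊕ q^ K · (Σodd m (O K) ⊕ O K)           ≈⟨ ⊕-congʳ (T m) (⊕-hom (q^-isLinear K) (Σodd m (O K)) (O K)) ⟩
    T m ⊕ (q^ K · Σodd m (O K) ⊕ q^ K · O K)    ≈⟨ ⊕-assoc (T m) (q^ K · Σodd m (O K)) (q^ K · O K) ⟨
    T m ⊕ q^ K · Σodd m (O K) ⊕ q^ K · O K      ≈⟨ ⊕-congˡ (q^ K · O K) Σodd-O≈ ⟨
    Σodd m (O K) ⊕ q^ K · O K                   ≈⟨ q^Sum-suc odd id m (O K) K-odd ⟨
    Σodd K (O K)                                ∎
    where
    open ≗-Reasoning
    K = suc m
    Σodd-O≈ : Σodd m (O K) ≗ T m ⊕ q^ K · Σodd m (O K)
    Σodd-O≈ = begin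
      Σodd m (O K)                              ≈⟨ ≗-hom (Σodd-isLinear m) (O-suc-odd m K-odd) ⟩
      Σodd m (O m ⊕ q^ K · O K)                 ≈⟨ ⊕-hom (Σodd-isLinear m) (O m) (q^ K · O K) ⟩
      Σodd m (O m) ⊕ Σodd m (q^ K · O K)        ≈⟨ ⊕-cong (sym ∘ T≈) (q^-hom (Σodd-isLinear m) K (O K)) ⟩
      T m ⊕ q^ K · Σodd m (O K)                 ∎
    T⁺≈ : T⁺ m ≗ Σodd m (O K) ⊕ O K
    T⁺≈ = fixedPoint-unique m (T m ⊕ O m) (T⁺-odd m K-odd) (begin
      Σodd m (O K) ⊕ O K                                  ≈⟨ ⊕-cong Σodd-O≈ (O-suc-odd m K-odd) ⟩
      (T m ⊕ q^ K · Σodd m (O K)) ⊕ (O m ⊕ q^ K · O K)    ≈⟨ ⊕-interchange (T m) (q^ K · Σodd m (O K)) (O m) (q^ K · O K) ⟩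
      (T m ⊕ O m) ⊕ (q^ K · Σodd m (O K) ⊕ q^ K · O K)    ≈⟨ ⊕-congʳ (T m ⊕ O m) (⊕-hom (q^-isLinear K) (Σodd m (O K)) (O K)) ⟨
      (T m ⊕ O m) ⊕ q^ K · (Σodd m (O K) ⊕ O K)           ∎)

  odd-parts-step-even : ∀ m → T m ≗ Σodd m (O m) → odd (suc m) ≡ false → T (suc m) ≗ Σodd (suc m) (O (suc m))
  odd-parts-step-even m T≈ K-even = begin
    T K                        ≈⟨ T-suc-even m K-even ⟩
    T m                        ≈⟨ T≈ ⟩
    Σodd m (O m)               ≈⟨ ≗-hom (Σodd-isLinear m) (O-suc-even m K-even) ⟨
    Σodd m (O K)               ≈⟨ q^Sum-suc-skip odd id m (O K) K-even ⟨
    Σodd K (O K)               ∎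
    where
    open ≗-Reasoning
    K = suc m

  odd-parts-identity : ∀ m → T m ≗ Σodd m (O m)
  odd-parts-identity zero    = gf-empty refl
  odd-parts-identity (suc m) =
    parity-cases (suc m) (odd-parts-step-odd m (odd-parts-identity m)) (odd-parts-step-even m (odd-parts-identity m))

  q²-Pochhammer-D-suc : ∀ r m →
    q²-Pochhammer r (D (suc m)) ≗ q²-Pochhammer r (D m) ⊕ q^ suc m · q²-Pochhammer r (D m)
  q²-Pochhammer-D-suc r m = begin
    P (D (suc m))                   ≈⟨ ≗-hom P-isLinear (D-suc m) ⟩
    P (D m ⊕ q^ suc m · D m)        ≈⟨ ⊕-hom P-isLinear (D m) (q^ suc m · D m) ⟩
    P (D m) ⊕ P (q^ suc m · D m)    ≈⟨ ⊕-congʳ (P (D m)) (q^-hom P-isLinear (suc m) (D m)) ⟩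
    P (D m) ⊕ q^ suc m · P (D m)    ∎
    where
    open ≗-Reasoning
    P = q²-Pochhammer r
    P-isLinear = q²-Pochhammer-isLinear r

  euler-even : ∀ r → q²-Pochhammer (r ℕ.+ r) (O (r ℕ.+ r)) ≗ q²-Pochhammer r (D (r ℕ.+ r))
  euler-odd  : ∀ r → q²-Pochhammer (suc (r ℕ.+ r)) (O (suc (r ℕ.+ r))) ≗ q²-Pochhammer r (D (suc (r ℕ.+ r)))

  euler-even zero = gf-base refl
  euler-even (suc r) rewrite ℕ.+-suc r r = begin
    (1−q^ (K ℕ.+ K)) (P M (O K))          ≈⟨ ≗-hom (1−q^-isLinear (K ℕ.+ K)) (≗-hom (P-isLinear M) (O-suc-even M K-even)) ⟩
    (1−q^ (K ℕ.+ K)) (P M (O M))          ≈⟨ ≗-hom (1−q^-isLinear (K ℕ.+ K)) (euler-odd r) ⟩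
    (1−q^ (K ℕ.+ K)) Z                    ≈⟨ 1−q^2k-factor K Z ⟩
    (1−q^ K) (Z ⊕ q^ K · Z)               ≈⟨ ≗-hom (1−q^-isLinear K) (q²-Pochhammer-D-suc r M) ⟨
    (1−q^ K) (P r (D K))                  ∎
    where
    open ≗-Reasoning
    P = q²-Pochhammer
    P-isLinear = q²-Pochhammer-isLinear
    M = suc (r ℕ.+ r)
    K = suc M
    Z = P r (D M)
    K-even : odd K ≡ false
    K-even = trans (odd-+2 (r ℕ.+ r)) (odd-double r)

  euler-odd r = begin
    (1−q^ (K ℕ.+ K)) (P M (O K))          ≈⟨ 1−q^2k-geometric K {a = Y} P-O≈ ⟩
    Y ⊕ q^ K · Y                          ≈⟨ q²-Pochhammer-D-suc r M ⟨
    P r (D K)                             ∎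
    where
    open ≗-Reasoning
    P = q²-Pochhammer
    P-isLinear = q²-Pochhammer-isLinear
    M = r ℕ.+ r
    K = suc M
    Y = P r (D M)
    P-O≈ : P M (O K) ≗ Y ⊕ q^ K · P M (O K)
    P-O≈ = begin
      P M (O K)                           ≈⟨ ≗-hom (P-isLinear M) (O-suc-odd M (odd-1+double r)) ⟩
      P M (O M ⊕ q^ K · O K)              ≈⟨ ⊕-hom (P-isLinear M) (O M) (q^ K · O K) ⟩
      P M (O M) ⊕ P M (q^ K · O K)        ≈⟨ ⊕-cong (euler-even r) (q^-hom (P-isLinear M) K (O K)) ⟩
      Y ⊕ q^ K · P M (O K)                ∎

  halve : ∀ n → ∃[ r ] (n ≡ r ℕ.+ r ⊎ n ≡ suc (r ℕ.+ r))
  halve zero = 0 , inj₁ refl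
  halve (suc n) with halve n
  ... | r , inj₁ refl = r , inj₂ refl
  ... | r , inj₂ refl = suc r , inj₁ (cong suc (sym (ℕ.+-suc r r)))

  euler : ∀ n → O n ≈ D n mod-q^ suc n
  euler n with halve n
  ... | r , inj₁ refl = q²-Pochhammer-injective r (suc n) λ i i≤n →
    trans (sym (q²-Pochhammer-stable r r (O n) i (ℕ.<-≤-trans i≤n (s≤s (ℕ.+-monoʳ-≤ r (ℕ.n≤1+n r))))))
          (euler-even r i)
  ... | r , inj₂ refl = q²-Pochhammer-injective r (suc n) λ i i≤n →
    trans (sym (q²-Pochhammer-stable (suc r) r (O n) i (ℕ.<-≤-trans i≤n (s≤s (ℕ.≤-reflexive (sym (ℕ.+-suc r r)))))))
          (euler-odd r i)

  distinct-parts-identity : ∀ m → L m ≗ C m ⊕ Δ m (D m)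
  distinct-parts-identity zero    n = trans (gf-empty refl n) (sym (cong (λ c → c + (+ 0 - + 0)) (gf-empty refl n)))
  distinct-parts-identity (suc m) n = begin
    L K n                                                ≡⟨ L-suc m n ⟩
    L m n + (q^ K · (L m ⊕ D m)) n                       ≡⟨ cong₂ _+_ (IH n) L-shifted ⟩
    (c + δ) + ((qc + qδ) + x₁)                           ≡⟨ regroup c δ qc qδ x₁ x₂ x₃ ⟩
    (c + (qc + x₃)) + ((δ + qδ) + (x₁ + x₂) - (x₂ + x₃)) ≡⟨ cong₂ _+_ C-expanded Δ-expanded ⟨
    C K n + Δ K (D K) n                                  ∎
    where
    open ≡-Reasoning
    K = suc m
    IH = distinct-parts-identity m
    qK = q^-isLinear K
    c  = C m n
    δ  = Δ m (D m) n
    qc = (q^ K · C m) n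
    qδ = (q^ K · Δ m (D m)) n
    x₁ = (q^ K · D m) n
    x₂ = (q^ K · q^ K · D m) n
    x₃ = (q^ K · q^ K · q^ K · D m) n
    regroup : ∀ c δ qc qδ x₁ x₂ x₃ →
      (c + δ) + ((qc + qδ) + x₁) ≡ (c + (qc + x₃)) + ((δ + qδ) + (x₁ + x₂) - (x₂ + x₃))
    regroup = solve-∀
    L-shifted : (q^ K · (L m ⊕ D m)) n ≡ (qc + qδ) + x₁
    L-shifted = trans (⊕-hom qK (L m) (D m) n)
                      (cong (_+ x₁) (trans (q^-cong K IH n) (⊕-hom qK (C m) (Δ m (D m)) n)))
    C-expanded : C K n ≡ c + (qc + x₃)
    C-expanded = trans (C-suc m n) (cong (_+_ c) (⊕-hom qK (C m) (q^ K · q^ K · D m) n))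
    D-shifted : q^ K · D K ≗ q^ K · D m ⊕ q^ K · q^ K · D m
    D-shifted i = trans (q^-cong K (D-suc m) i) (⊕-hom qK (D m) (q^ K · D m) i)
    Δ-D : Δ m (D K) n ≡ δ + qδ
    Δ-D = trans (≗-hom (Δ-isLinear m) (D-suc m) n)
                (trans (⊕-hom (Δ-isLinear m) (D m) (q^ K · D m) n)
                       (cong (_+_ δ) (q^-hom (Δ-isLinear m) K (D m) n)))
    Δ-expanded : Δ K (D K) n ≡ (δ + qδ) + (x₁ + x₂) - (x₂ + x₃)
    Δ-expanded = trans (Δ-suc m (D K) n)
      (cong₂ (λ u v → u - v) (cong₂ _+_ Δ-D (D-shifted n))
                            (trans (q^-cong K D-shifted n) (⊕-hom qK (q^ K · D m) (q^ K · q^ K · D m) n)))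

  partitions-identity : ∀ n → L n n ≡ C n n + T n n
  partitions-identity n = begin
    L n n                    ≡⟨ distinct-parts-identity n n ⟩
    C n n + Δ n (D n) n      ≡⟨ cong (_+_ (C n n)) (Δ≈Σodd n (D n) n ℕ.≤-refl) ⟩
    C n n + Σodd n (D n) n   ≡⟨ cong (_+_ (C n n)) (mod-hom (Σodd-isLinear n) (suc n) (euler n) n ℕ.≤-refl) ⟨
    C n n + Σodd n (O n) n   ≡⟨ cong (_+_ (C n n)) (odd-parts-identity n n) ⟨
    C n n + T n n            ∎
    where open ≡-Reasoning

theorem2 : (n : ℕ) → 1 ≤ n → + c₁ n ≡ b₁ n
theorem2 n _ = begin
  + c₁ n                                           ≡⟨ cong +_ (count≡partitionSum isC1 n) ⟩
  C n n                                            ≡⟨ +-cancel (C n n) (T n n) ⟨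
  C n n + T n n - T n n                            ≡⟨ cong (_- T n n) (partitions-identity n) ⟨
  L n n - T n n                                    ≡⟨ cong₂ (λ l t → + l - + t) (sum-filter isDistinct length (partitions n))
                                                                               (sum-filter isOdd _ (partitions n)) ⟨
  b₁ n                                             ∎
  where
  open import Data.Integer using (_+_; _-_)
  open import Data.Integer.Tactic.RingSolver using (solve-∀)
  open import Data.List using (length)
  open import Relation.Binary.PropositionalEquality
  open BoundedPartitions using (sum-filter; count≡partitionSum)
  open Recurrences using (L; C; T)
  open Identities using (partitions-identity)
  open ≡-Reasoning
  +-cancel : ∀ x y → x + y - y ≡ x
  +-cancel = solve-∀
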